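{- Let $(a,b,c,\dots,m)$ be a tuple of positive integers with at least two terms, first term $a$ and last term $m$, and suppose a jump of order $r>1$ transforms it into $(a-r,\,r,\,b,\,c,\dots,m)$. Then the number of elements of the jump set of order 1 of $(a-r,r,b,c,\dots,m)$ is smaller by exactly $r$ than the number of elements of the jump set of order 1 of $(a,b,c,\dots,m)$ (these numbers being $a-r-m+1$ and $a-m+1$ respectively).
   Context: Partitions are written as finite ordered tuples of positive integers. For an integer $r\ge 1$, a jump of order $r$ transforms a tuple $(a_1,a_2,\dots,a_k)$ into $(a_1-r,\,r,\,a_2,\dots,a_k)$; it is allowed only when $a_1-r$ is not less than the last term of the resulting tuple and $r$ is not greater than any of the terms $a_2,\dots,a_k$. The jump set of order 1 of a tuple is the set consisting of the tuple itself together with all tuples obtained from it by repeated (successive) application of jumps of order 1. -}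

module Defs where

open import Data.Nat using (ℕ; _∸_; _≤_; _<_)
open import Data.List using (List; []; _∷_; length)
open import Data.List.Relation.Unary.All using (All)
open import Data.List.Relation.Unary.Unique.Propositional using (Unique)
open import Data.List.Membership.Propositional using (_∈_)
open import Data.Product using (∃; _×_)
open import Function.Bundles using (_⇔_)
open import Relation.Binary.PropositionalEquality using (_≡_)
open import Relation.Binary.Construct.Closure.ReflexiveTransitive using (Star)

-- Partitions / tuples are lists of natural numbers (positivity is a separate hypothesis).
Tuple : Set
Tuple = List ℕ

lastOf : ℕ → List ℕ → ℕ
lastOf x []       = x
lastOf _ (y ∷ ys) = lastOf y ys

-- A jump of order r: (a₁, a₂, …, a_k) ↦ (a₁ - r, r, a₂, …, a_k),
-- allowed when r ≥ 1, r ≤ a₁ (so a₁ - r is an honest subtraction),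
-- a₁ - r ≥ last term of the result, and r ≤ every a₂,…,a_k.
data Jump (r : ℕ) : Tuple → Tuple → Set where
  jump : ∀ {a} {rest : List ℕ} →
         1 ≤ r → r ≤ a →
         lastOf r rest ≤ a ∸ r →
         All (r ≤_) rest →
         Jump r (a ∷ rest) (a ∸ r ∷ r ∷ rest)

JumpSet₁ : Tuple → Tuple → Set
JumpSet₁ t u = Star (Jump 1) t u

HasCard : (Tuple → Set) → ℕ → Set
HasCard S n = ∃ λ (L : List Tuple) → Unique L × (∀ u → (u ∈ L) ⇔ S u) × length L ≡ n

{-# OPTIONS --safe #-}
module Submission where

-- A jump of order 1 inserts a 1 in second position, so it keeps the last term m, and a
-- tuple admits at most one such jump. Hence the jump set of (x, y, …) is the chain
-- (x, y, …) → (x−1, 1, y, …) → (x−2, 1, 1, y, …) → …, which stops when the first term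
-- reaches m, and has x − m + 1 elements. Both tuples of the theorem have last term m.

open import Defs
open import Data.Nat using (ℕ; zero; suc; _+_; _∸_; _≤_; _<_; s≤s; z≤n)
open import Data.Nat.Properties
open import Data.List using (List; []; _∷_; length)
open import Data.List.Relation.Unary.All as All using (All; []; _∷_)
open import Data.List.Relation.Unary.AllPairs as AllPairs using ()
open import Data.List.Relation.Unary.Any using (here; there)
open import Data.List.Membership.Propositional using (_∈_)
open import Data.Product using (∃₂; _×_; _,_)
open import Function.Bundles using (mk⇔; Equivalence)
open import Relation.Binary.PropositionalEquality
open import Relation.Nullary using (¬_; contradiction)
open import Relation.Binary.Construct.Closure.ReflexiveTransitive using (ε; _◅_)

lastOf-positive : ∀ y ys → All (1 ≤_) (y ∷ ys) → 1 ≤ lastOf y ys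
lastOf-positive y []       (p ∷ _)  = p
lastOf-positive y (z ∷ zs) (_ ∷ ps) = lastOf-positive z zs ps

JumpSet₁-length-≤ : ∀ {t u} → JumpSet₁ t u → length t ≤ length u
JumpSet₁-length-≤ ε                  = ≤-refl
JumpSet₁-length-≤ (jump _ _ _ _ ◅ s) = ≤-trans (n≤1+n _) (JumpSet₁-length-≤ s)

positive⇒≰pred : ∀ {m} → 1 ≤ m → ¬ m ≤ m ∸ 1
positive⇒≰pred {suc m} _ = <⇒≱ (n<1+n m)

JumpSet₁-card-base : ∀ y ys → All (1 ≤_) (y ∷ ys) →
  HasCard (JumpSet₁ (lastOf y ys ∷ y ∷ ys)) 1
JumpSet₁-card-base y ys ps = (t ∷ []) , ([] AllPairs.∷ AllPairs.[]) , (λ u → mk⇔ (to u) (from u)) , refl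
  where
  t : Tuple
  t = lastOf y ys ∷ y ∷ ys
  to : ∀ u → u ∈ (t ∷ []) → JumpSet₁ t u
  to u (here refl) = ε
  from : ∀ u → JumpSet₁ t u → u ∈ (t ∷ [])
  from u ε                        = here refl
  from u (jump _ _ m≤m∸1 _ ◅ _) = contradiction m≤m∸1 (positive⇒≰pred (lastOf-positive y ys ps))

JumpSet₁-card-step : ∀ d y ys → All (1 ≤_) (y ∷ ys) →
  HasCard (JumpSet₁ (d + lastOf y ys ∷ 1 ∷ y ∷ ys)) (suc d) →
  HasCard (JumpSet₁ (suc d + lastOf y ys ∷ y ∷ ys)) (suc (suc d))
JumpSet₁-card-step d y ys ps (L , L-unique , L⇔ , L-length) =
  (t ∷ L) , (All.tabulate t∉L AllPairs.∷ L-unique) , (λ u → mk⇔ (to u) (from u)) , cong suc L-length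
  where
  m : ℕ
  m = lastOf y ys
  t : Tuple
  t = suc d + m ∷ y ∷ ys
  t⟶ : Jump 1 t (d + m ∷ 1 ∷ y ∷ ys)
  t⟶ = jump (s≤s z≤n) (s≤s z≤n) (m≤n+m m d) ps
  t∉L : ∀ {x} → x ∈ L → t ≢ x
  t∉L {x} x∈L refl = <⇒≱ ≤-refl (JumpSet₁-length-≤ (Equivalence.to (L⇔ x) x∈L))
  to : ∀ u → u ∈ (t ∷ L) → JumpSet₁ t u
  to u (here refl)  = ε
  to u (there u∈L) = t⟶ ◅ Equivalence.to (L⇔ u) u∈L
  from : ∀ u → JumpSet₁ t u → u ∈ (t ∷ L)
  from u ε                  = here refl
  from u (jump _ _ _ _ ◅ s) = there (Equivalence.from (L⇔ u) s)

JumpSet₁-card-+ : ∀ d y ys → All (1 ≤_) (y ∷ ys) →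
  HasCard (JumpSet₁ (d + lastOf y ys ∷ y ∷ ys)) (suc d)
JumpSet₁-card-+ zero    y ys ps = JumpSet₁-card-base y ys ps
JumpSet₁-card-+ (suc d) y ys ps =
  JumpSet₁-card-step d y ys ps (JumpSet₁-card-+ d 1 (y ∷ ys) (s≤s z≤n ∷ ps))

JumpSet₁-card : ∀ x y ys → All (1 ≤_) (y ∷ ys) → lastOf y ys ≤ x →
  HasCard (JumpSet₁ (x ∷ y ∷ ys)) (x ∸ lastOf y ys + 1)
JumpSet₁-card x y ys ps m≤x =
  subst₂ (λ x′ n → HasCard (JumpSet₁ (x′ ∷ y ∷ ys)) n) (m∸n+n≡m m≤x) (+-comm 1 (x ∸ lastOf y ys))
    (JumpSet₁-card-+ (x ∸ lastOf y ys) y ys ps)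

∸-∸-+-+ : ∀ a r m → r ≤ a → m ≤ a ∸ r → a ∸ r ∸ m + 1 + r ≡ a ∸ m + 1
∸-∸-+-+ a r m r≤a m≤a∸r = begin
  a ∸ r ∸ m + 1 + r   ≡⟨ +-assoc (a ∸ r ∸ m) 1 r ⟩
  a ∸ r ∸ m + (1 + r) ≡⟨ cong (a ∸ r ∸ m +_) (+-comm 1 r) ⟩
  a ∸ r ∸ m + (r + 1) ≡⟨ +-assoc (a ∸ r ∸ m) r 1 ⟨
  a ∸ r ∸ m + r + 1   ≡⟨ cong (_+ 1) (+-∸-comm r m≤a∸r) ⟨
  a ∸ r + r ∸ m + 1   ≡⟨ cong (λ x → x ∸ m + 1) (m∸n+n≡m r≤a) ⟩
  a ∸ m + 1           ∎
  where open ≡-Reasoning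

mainTheorem5 : (a b : ℕ) (cs : List ℕ) (r : ℕ) →
    All (1 ≤_) (a ∷ b ∷ cs) →
    1 < r →
    Jump r (a ∷ b ∷ cs) (a ∸ r ∷ r ∷ b ∷ cs) →
    ∃₂ λ n n′ →
    HasCard (JumpSet₁ (a ∷ b ∷ cs)) n ×
    HasCard (JumpSet₁ (a ∸ r ∷ r ∷ b ∷ cs)) n′ ×
    n′ + r ≡ n ×
    n ≡ a ∸ lastOf b cs + 1 ×
    n′ ≡ a ∸ r ∸ lastOf b cs + 1
mainTheorem5 a b cs r (_ ∷ ps) 1<r (jump _ r≤a m≤a∸r _) =
  _ , _ ,
  JumpSet₁-card a b cs ps (≤-trans m≤a∸r (m∸n≤m a r)) ,
  JumpSet₁-card (a ∸ r) r (b ∷ cs) (<⇒≤ 1<r ∷ ps) m≤a∸r ,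
  ∸-∸-+-+ a r (lastOf b cs) r≤a m≤a∸r , refl , refl
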